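{- Let $n$ be a positive integer and let $\ell$ be a positive definite binary $\mathbb{Z}$-lattice with $\mathfrak{n}\ell=\mathbb{Z}$ and discriminant $D_\ell$. Let $p$ be a prime such that either (1) $\left(\frac{D_\ell}{p}\right)=-1$, or (2) $\left(\frac{D_\ell}{p}\right)=1$ and $p\in Q(\mathcal{D})$ for some ambiguous class $\mathcal{D}\in\mathfrak{S}_{D_\ell}$. If $np^2$ is represented by $\ell$, then $n$ is represented by $\ell$.
   Context: A $\mathbb{Z}$-lattice is a free $\mathbb{Z}$-module with a positive definite symmetric bilinear form $B$ (rational values), $Q(x)=B(x,x)$. The norm ideal $\mathfrak{n}\ell$ is the $\mathbb{Z}$-module generated by $\{Q(x): x\in\ell\}$. For a binary lattice $\ell$ with Gram matrix $\begin{pmatrix} a & b/2\\ b/2 & c\end{pmatrix}$ one sets $D_\ell=-4\det(\text{Gram})=b^2-4ac$; then $\mathfrak{n}\ell=\gcd(a,b,c)\mathbb{Z}$. An integer $m$ is represented by $\ell$ if $Q(x)=m$ for some $x\in\ell$. For a negative integer $D\equiv 0,1\pmod 4$, $\mathfrak{S}_D$ denotes the form class group: the set of proper ($\mathrm{SL}_2(\mathbb{Z})$-)equivalence classes of positive definite binary quadratic forms $ax^2+bxy+cy^2$ with $\gcd(a,b,c)=1$ and $b^2-4ac=D$, a finite abelian group under Gauss composition with identity the principal class $\mathcal{E}$. A class $\mathcal{C}$ is ambiguous if $\mathcal{C}^2=\mathcal{E}$. $Q(\mathcal{C})$ is the set of integers represented by a form in $\mathcal{C}$. $\left(\frac{D}{p}\right)$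 is the Kronecker symbol. -}

module Defs where

open import Data.Nat using (ℕ)
open import Data.Nat.Primality using (Prime)
open import Data.Integer using (ℤ; +_; _+_; _-_; _*_; _<_; 0ℤ; 1ℤ)
open import Data.Integer.Divisibility using (_∣_)
open import Data.Product using (Σ; ∃; ∃-syntax; _×_; _,_)
open import Data.Sum using (_⊎_)
open import Relation.Nullary using (¬_)
open import Relation.Binary.PropositionalEquality using (_≡_)

-- A binary Z-lattice ℓ with 𝔫ℓ ⊆ ℤ, written in a basis: Gram matrix
-- (a , b/2 ; b/2 , c) with a b c ∈ ℤ, i.e. Q(x e₁ + y e₂) = a x² + b x y + c y².
record Form : Set where
  constructor form
  field
    a b c : ℤ
open Form public

eval : Form → ℤ → ℤ → ℤ
eval f x y = a f * x * x + b f * x * y + c f * y * y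

disc : Form → ℤ
disc f = b f * b f - + 4 * a f * c f

PosDef : Form → Set
PosDef f = (0ℤ < a f) × (disc f < 0ℤ)

-- gcd(a,b,c) = 1, i.e. 𝔫ℓ = ℤ
Coprime3 : ℤ → ℤ → ℤ → Set
Coprime3 x y z = ∀ d → d ∣ x → d ∣ y → d ∣ z → d ∣ 1ℤ

Primitive : Form → Set
Primitive f = Coprime3 (a f) (b f) (c f)

Represents : Form → ℤ → Set
Represents f m = ∃[ x ] ∃[ y ] eval f x y ≡ m

_≈F_ : Form → Form → Set
g ≈F f = ∃[ α ] ∃[ β ] ∃[ γ ] ∃[ δ ]
  ((α * δ - β * γ ≡ 1ℤ) ×
   (∀ x y → eval g x y ≡ eval f (α * x + β * y) (γ * x + δ * y)))

Principal : Form → Set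
Principal h = ∃[ b₀ ] ∃[ c₀ ] ((disc (form 1ℤ b₀ c₀) ≡ disc h) × (h ≈F form 1ℤ b₀ c₀))

DirichletComp : Form → Form → Form → Set
DirichletComp f₁ f₂ h =
  (disc f₁ ≡ disc f₂) ×
  (∃[ e ] ((b f₁ + b f₂ ≡ + 2 * e) × Coprime3 (a f₁) (a f₂) e)) ×
  (a h ≡ a f₁ * a f₂) ×
  (disc h ≡ disc f₁) ×
  ((+ 2 * a f₁) ∣ (b h - b f₁)) ×
  ((+ 2 * a f₂) ∣ (b h - b f₂))

-- The class of g is ambiguous: (class of g)² = principal class.
Ambiguous : Form → Set
Ambiguous g = ∃[ g₁ ] ∃[ g₂ ] ∃[ h ]
  ((g₁ ≈F g) × (g₂ ≈F g) × DirichletComp g₁ g₂ h × Principal h)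

QR : ℤ → ℕ → Set
QR D p = ∃[ x ] ((+ p) ∣ (x * x - D))

KronMinusOne : ℤ → ℕ → Set
KronMinusOne D p =
  ((p ≡ 2) × ((+ 8 ∣ (D - + 3)) ⊎ (+ 8 ∣ (D + + 3)))) ⊎
  (¬ (p ≡ 2) × ¬ ((+ p) ∣ D) × ¬ QR D p)

KronOne : ℤ → ℕ → Set
KronOne D p =
  ((p ≡ 2) × ((+ 8 ∣ (D - 1ℤ)) ⊎ (+ 8 ∣ (D + 1ℤ)))) ⊎
  (¬ (p ≡ 2) × ¬ ((+ p) ∣ D) × QR D p)

InAmbiguousQ : ℤ → ℕ → Set
InAmbiguousQ D p = ∃[ g ]
  (Primitive g × PosDef g × (disc g ≡ D) × Ambiguous g × Represents g (+ p))

{-# OPTIONS --safe #-}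
-- If (D/p) = -1, then 4a Q(x, y) = (2ax + by)² - D y² shows that Q(x, y) ≡ 0 (mod p²) forces
-- p ∣ x and p ∣ y, since D is not a square mod p (mod 8 when p = 2); dividing (x, y) by p represents n.
--
-- If (D/p) = 1 and p is represented by a form g of an ambiguous class, the representation carries
-- a label: a square root ρ of D mod p (mod 4 when p = 2), and ±ρ are distinct because p ∤ D.
-- As g² is principal, Dirichlet-composing the representation with itself, with equal labels, yields
-- a representation p² = s² + b₀st + c₀t² by the principal form with p ∤ t, i.e. an element σ of norm
-- p² of the order of discriminant D that is not divisible by p. The lattice ℓ is a module over this
-- order, and a primitive v with Q(v) = n p² is an eigenvector mod p² of σ and of its conjugate σ̄.
-- The two eigenvalues multiply to N(σ) ≡ 0 and cannot both be divisible by p (p ∤ D), so p² divides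
-- σ v or σ̄ v, and the quotient w satisfies Q(w) = n.
module Submission where

open import Defs
open import Data.Nat using (ℕ; suc)
open import Data.Nat.Primality using (Prime)
open import Data.Integer using (ℤ; +_; _*_)
open import Data.Sum using (_⊎_)
open import Data.Product using (_×_)

import Data.Nat as ℕ
open import Data.Nat using (z≤n; s≤s)
open import Data.Nat.Primality using (prime[2]; euclidsLemma; prime⇒irreducible; ¬prime[1]; prime⇒nonZero)
open import Data.Nat.Coprimality using (Coprime; coprime-Bézout)
open import Data.Nat.GCD using (module Bézout)
open import Data.Nat.Divisibility using (∣1⇒≡1) renaming (_∣_ to _∣ℕ_)
open import Data.Integer using (_+_; _-_; -_; 0ℤ; 1ℤ; -[1+_]; _<_; _≤_; +≤+; ≢-nonZero)
  renaming (∣_∣ to abs)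
-- Divisibility below is the signed one; Defs uses the unsigned one (∣ᵤ⇒∣ and ∣⇒∣ᵤ translate).
open import Data.Integer.Divisibility.Signed
  using ( divides; _∣_; _∣?_; ∣ᵤ⇒∣; ∣⇒∣ᵤ; ∣-refl; ∣-trans; ∣m∣n⇒∣m+n; ∣n⇒∣m*n; ∣m⇒∣m*n; ∣m⇒∣-m
        ; *-cancelʳ-∣; *-monoʳ-∣)
open import Data.Integer.DivMod using (_%ℕ_; _/ℕ_; n%ℕd<d; a≡a%ℕn+[a/ℕn]*n)
import Data.Integer.Properties as ℤ
open import Data.Integer.Tactic.RingSolver using (solve-∀)
open import Data.Product using (Σ; ∃-syntax; _,_; proj₁; proj₂; map₂; swap; uncurry)
open import Data.Sum using (inj₁; inj₂; [_,_]′)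
import Data.Sum as Sum
open import Data.Empty using (⊥; ⊥-elim)
open import Function using (_∘_; id)
open import Relation.Nullary using (¬_; Dec; yes; no)
open import Relation.Nullary.Decidable using (decidable-stable; from-no)
open import Relation.Binary.PropositionalEquality

∣-linear₁ : ∀ {k x e} u → e ≡ u * x → k ∣ x → k ∣ e
∣-linear₁ u refl k∣x = ∣n⇒∣m*n u k∣x

∣-linear₂ : ∀ {k x y e} u v → e ≡ u * x + v * y → k ∣ x → k ∣ y → k ∣ e
∣-linear₂ u v refl k∣x k∣y = ∣m∣n⇒∣m+n (∣n⇒∣m*n u k∣x) (∣n⇒∣m*n v k∣y)

∣-linear₃ : ∀ {k x y z e} u v w → e ≡ u * x + v * y + w * z → k ∣ x → k ∣ y → k ∣ z → k ∣ e
∣-linear₃ u v w refl k∣x k∣y k∣z =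
  ∣m∣n⇒∣m+n (∣-linear₂ u v refl k∣x k∣y) (∣n⇒∣m*n w k∣z)

∣-linear₄ : ∀ {k x y z t e} u v w s → e ≡ u * x + v * y + w * z + s * t →
            k ∣ x → k ∣ y → k ∣ z → k ∣ t → k ∣ e
∣-linear₄ u v w s refl k∣x k∣y k∣z k∣t =
  ∣m∣n⇒∣m+n (∣-linear₃ u v w refl k∣x k∣y k∣z) (∣n⇒∣m*n s k∣t)

module ModPrime (p : ℕ) (p-prime : Prime p) where

  P : ℤ
  P = + p

  P∣xy⇒P∣x⊎P∣y : ∀ x y → P ∣ x * y → P ∣ x ⊎ P ∣ y
  P∣xy⇒P∣x⊎P∣y x y P∣xy =
    Sum.map ∣ᵤ⇒∣ ∣ᵤ⇒∣
      (euclidsLemma (abs x) (abs y) p-prime (subst (p ∣ℕ_) (ℤ.abs-* x y) (∣⇒∣ᵤ P∣xy)))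

  P∣x²⇒P∣x : ∀ {x} → P ∣ x * x → P ∣ x
  P∣x²⇒P∣x {x} P∣x² = [ id , id ]′ (P∣xy⇒P∣x⊎P∣y x x P∣x²)

  P∤1 : ¬ P ∣ 1ℤ
  P∤1 P∣1 = ¬prime[1] (subst Prime (∣1⇒≡1 (∣⇒∣ᵤ P∣1)) p-prime)

  coprime : ∀ {x} → ¬ P ∣ x → Coprime p (abs x)
  coprime P∤x {i} (i∣p , i∣x) with prime⇒irreducible p-prime i∣p
  ... | inj₁ i≡1 = i≡1
  ... | inj₂ refl = ⊥-elim (P∤x (∣ᵤ⇒∣ i∣x))

  ℕ-identity⇒ℤ : ∀ k u m v w → k ℕ.+ u ℕ.* m ≡ v ℕ.* w → + k + + u * + m ≡ + v * + w
  ℕ-identity⇒ℤ k u m v w eq =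
    trans (cong (_+_ (+ k)) (sym (ℤ.pos-* u m))) (trans (cong +_ eq) (ℤ.pos-* v w))

  inverse-ℕ : ∀ {n} → Coprime p n → ∃[ y ] P ∣ + n * y - 1ℤ
  inverse-ℕ {n} p⊥n with coprime-Bézout p⊥n
  ... | Bézout.+- u v eq = - + v , divides (- + u) (begin
    + n * - + v - 1ℤ  ≡⟨ flip-sign (+ n) (+ v) ⟩
    - (1ℤ + + v * + n) ≡⟨ cong -_ (ℕ-identity⇒ℤ 1 v n u p eq) ⟩
    - (+ u * P)        ≡⟨ ℤ.neg-distribˡ-* (+ u) P ⟩
    - + u * P          ∎)
    where
    open ≡-Reasoning
    flip-sign : ∀ n v → n * - v - 1ℤ ≡ - (1ℤ + v * n)
    flip-sign = solve-∀
  ... | Bézout.-+ u v eq = + v , divides (+ u) (begin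
    + n * + v - 1ℤ         ≡⟨ cong (_- 1ℤ) (ℤ.*-comm (+ n) (+ v)) ⟩
    + v * + n - 1ℤ         ≡⟨ cong (_- 1ℤ) (sym (ℕ-identity⇒ℤ 1 u p v n eq)) ⟩
    1ℤ + + u * P - 1ℤ      ≡⟨ cancel-one (+ u * P) ⟩
    + u * P                ∎)
    where
    open ≡-Reasoning
    cancel-one : ∀ z → 1ℤ + z - 1ℤ ≡ z
    cancel-one = solve-∀

  inverse : ∀ {x} → ¬ P ∣ x → ∃[ y ] P ∣ x * y - 1ℤ
  inverse {+ n} P∤x = inverse-ℕ (coprime P∤x)
  inverse { -[1+ n ]} P∤x with inverse-ℕ {suc n} (coprime P∤x)
  ... | y , P∣ = - y , subst (P ∣_) (negate-both (+ suc n) y) P∣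
    where
    negate-both : ∀ m y → m * y - 1ℤ ≡ - m * - y - 1ℤ
    negate-both = solve-∀

  -- Newton's step y ↦ y (2 - x y) squares the error x y - 1.
  inverse² : ∀ {x} → ¬ P ∣ x → ∃[ y ] P * P ∣ x * y - 1ℤ
  inverse² {x} P∤x with inverse P∤x
  ... | y , divides r eq = y * (+ 2 - x * y) , divides (- (r * r)) (begin
    x * (y * (+ 2 - x * y)) - 1ℤ    ≡⟨ newton x y ⟩
    - ((x * y - 1ℤ) * (x * y - 1ℤ)) ≡⟨ cong (λ e → - (e * e)) eq ⟩
    - ((r * P) * (r * P))           ≡⟨ regroup r P ⟩
    - (r * r) * (P * P)             ∎)
    where
    open ≡-Reasoning
    newton : ∀ x y → x * (y * (+ 2 - x * y)) - 1ℤ ≡ - ((x * y - 1ℤ) * (x * y - 1ℤ))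
    newton = solve-∀
    regroup : ∀ r P → - ((r * P) * (r * P)) ≡ - (r * r) * (P * P)
    regroup = solve-∀

  cancel : ∀ {q z x} → q ∣ P * P → q ∣ z * x → ¬ P ∣ x → q ∣ z
  cancel {q} {z} {x} q∣P² q∣zx P∤x with inverse² P∤x
  ... | y , P²∣xy-1 = ∣-linear₂ y (- z) (identity z x y) q∣zx (∣-trans q∣P² P²∣xy-1)
    where
    identity : ∀ z x y → z ≡ y * (z * x) + - z * (x * y - 1ℤ)
    identity = solve-∀

  p-Primitive : ℤ → ℤ → Set
  p-Primitive x y = ¬ (P ∣ x × P ∣ y)

  p-primitive-unit : ∀ {x y} → p-Primitive x y → ¬ P ∣ x ⊎ ¬ P ∣ y
  p-primitive-unit {x} {y} prim with P ∣? x
  ... | yes P∣x = inj₂ (λ P∣y → prim (P∣x , P∣y))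
  ... | no P∤x = inj₁ P∤x

  cancel-primitive : ∀ {q z x y} → q ∣ P * P → p-Primitive x y → q ∣ z * x → q ∣ z * y → q ∣ z
  cancel-primitive q∣P² prim q∣zx q∣zy =
    [ cancel q∣P² q∣zx , cancel q∣P² q∣zy ]′ (p-primitive-unit prim)

  proportional-unit : ∀ {q x y u v} → q ∣ P * P → ¬ P ∣ x → q ∣ x * v - y * u →
                      ∃[ μ ] (q ∣ u - μ * x × q ∣ v - μ * y)
  proportional-unit {q} {x} {y} {u} {v} q∣P² P∤x q∣det with inverse² P∤x
  ... | x⁻¹ , P²∣xx⁻¹-1 = u * x⁻¹ ,
      ∣-linear₁ (- u) (first u x x⁻¹) q∣xx⁻¹-1 ,
      cancel q∣P² (∣-linear₂ 1ℤ (- (y * u)) (second x y u v x⁻¹) q∣det q∣xx⁻¹-1) P∤x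
    where
    first : ∀ u x x⁻¹ → u - u * x⁻¹ * x ≡ - u * (x * x⁻¹ - 1ℤ)
    first = solve-∀
    second : ∀ x y u v x⁻¹ →
      (v - u * x⁻¹ * y) * x ≡ 1ℤ * (x * v - y * u) + - (y * u) * (x * x⁻¹ - 1ℤ)
    second = solve-∀
    q∣xx⁻¹-1 : q ∣ x * x⁻¹ - 1ℤ
    q∣xx⁻¹-1 = ∣-trans q∣P² P²∣xx⁻¹-1

  proportional : ∀ {q x y u v} → q ∣ P * P → p-Primitive x y → q ∣ x * v - y * u →
                 ∃[ μ ] (q ∣ u - μ * x × q ∣ v - μ * y)
  proportional {q} {x} {y} {u} {v} q∣P² prim q∣det with p-primitive-unit prim
  ... | inj₁ P∤x = proportional-unit q∣P² P∤x q∣det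
  ... | inj₂ P∤y =
    map₂ swap (proportional-unit q∣P² P∤y (subst (q ∣_) (transpose x y u v) (∣m⇒∣-m q∣det)))
    where
    transpose : ∀ x y u v → - (x * v - y * u) ≡ y * u - x * v
    transpose = solve-∀

  cancel-P² : ∀ {x y} → x * (P * P) ≡ y * (P * P) → x ≡ y
  cancel-P² {x} {y} eq = ℤ.*-cancelʳ-≡ x y P {{P≢0}} (ℤ.*-cancelʳ-≡ (x * P) (y * P) P {{P≢0}}
    (trans (ℤ.*-assoc x P P) (trans eq (sym (ℤ.*-assoc y P P)))))
    where P≢0 = prime⇒nonZero p-prime

  eval-scaled : ∀ f X Y → eval f (X * P) (Y * P) ≡ eval f X Y * (P * P)
  eval-scaled (form A B C) X Y = identity A B C X Y P
    where
    identity : ∀ A B C X Y P →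
      A * (X * P) * (X * P) + B * (X * P) * (Y * P) + C * (Y * P) * (Y * P)
      ≡ (A * X * X + B * X * Y + C * Y * Y) * (P * P)
    identity = solve-∀

  P²∣eval : ∀ f {x y} → P ∣ x → P ∣ y → P * P ∣ eval f x y
  P²∣eval f (divides X refl) (divides Y refl) = divides (eval f X Y) (eval-scaled f X Y)

  descend : ∀ f {N x y} → P ∣ x → P ∣ y → eval f x y ≡ N * (P * P) → Represents f N
  descend f (divides X refl) (divides Y refl) eq = X , Y , cancel-P² (trans (sym (eval-scaled f X Y)) eq)

  represents-P⇒primitive : ∀ f {x y} → eval f x y ≡ P → p-Primitive x y
  represents-P⇒primitive f fxy≡P (P∣x , P∣y) =
    P∤1 (*-cancelʳ-∣ P {{prime⇒nonZero p-prime}}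
      (subst (P * P ∣_) (trans fxy≡P (sym (ℤ.*-identityˡ P))) (P²∣eval f P∣x P∣y)))

record SL₂ : Set where
  constructor sl₂
  field
    α β γ δ : ℤ
    det≡1 : α * δ - β * γ ≡ 1ℤ

_·_ : Form → SL₂ → Form
f · M = form (eval f α γ) (+ 2 * a f * α * β + b f * (α * δ + β * γ) + + 2 * c f * γ * δ) (eval f β δ)
  where open SL₂ M

form-≡ : ∀ {a a′ b b′ c c′} → a ≡ a′ → b ≡ b′ → c ≡ c′ → form a b c ≡ form a′ b′ c′
form-≡ refl refl refl = refl

eval-· : ∀ f M x y → let open SL₂ M in eval (f · M) x y ≡ eval f (α * x + β * y) (γ * x + δ * y)
eval-· (form A B C) (sl₂ α β γ δ _) = identity A B C α β γ δ
  where
  identity : ∀ A B C α β γ δ x y →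
    (A * α * α + B * α * γ + C * γ * γ) * x * x
      + (+ 2 * A * α * β + B * (α * δ + β * γ) + + 2 * C * γ * δ) * x * y
      + (A * β * β + B * β * δ + C * δ * δ) * y * y
    ≡ A * (α * x + β * y) * (α * x + β * y) + B * (α * x + β * y) * (γ * x + δ * y)
      + C * (γ * x + δ * y) * (γ * x + δ * y)
  identity = solve-∀

disc-· : ∀ f M → disc (f · M) ≡ disc f
disc-· (form A B C) (sl₂ α β γ δ det≡1) = begin
  disc (form A B C · sl₂ α β γ δ det≡1)                   ≡⟨ identity A B C α β γ δ ⟩
  (α * δ - β * γ) * (α * δ - β * γ) * disc (form A B C)  ≡⟨ cong (λ e → e * e * disc (form A B C)) det≡1 ⟩
  1ℤ * 1ℤ * disc (form A B C)                             ≡⟨ ℤ.*-identityˡ _ ⟩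
  disc (form A B C)                                       ∎
  where
  open ≡-Reasoning
  identity : ∀ A B C α β γ δ →
    (+ 2 * A * α * β + B * (α * δ + β * γ) + + 2 * C * γ * δ)
      * (+ 2 * A * α * β + B * (α * δ + β * γ) + + 2 * C * γ * δ)
      - + 4 * (A * α * α + B * α * γ + C * γ * γ) * (A * β * β + B * β * δ + C * δ * δ)
    ≡ (α * δ - β * γ) * (α * δ - β * γ) * (B * B - + 4 * A * C)
  identity = solve-∀

form-ext : ∀ {g h} → (∀ x y → eval g x y ≡ eval h x y) → g ≡ h
form-ext {form A B C} {form A′ B′ C′} g≗h = form-≡ a≡ b≡ c≡
  where
  at-1,0 : ∀ A B C → A * 1ℤ * 1ℤ + B * 1ℤ * 0ℤ + C * 0ℤ * 0ℤ ≡ A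
  at-1,0 = solve-∀
  at-0,1 : ∀ A B C → A * 0ℤ * 0ℤ + B * 0ℤ * 1ℤ + C * 1ℤ * 1ℤ ≡ C
  at-0,1 = solve-∀
  at-1,1 : ∀ A B C → A * 1ℤ * 1ℤ + B * 1ℤ * 1ℤ + C * 1ℤ * 1ℤ ≡ A + B + C
  at-1,1 = solve-∀
  a≡ : A ≡ A′
  a≡ = trans (sym (at-1,0 A B C)) (trans (g≗h 1ℤ 0ℤ) (at-1,0 A′ B′ C′))
  c≡ : C ≡ C′
  c≡ = trans (sym (at-0,1 A B C)) (trans (g≗h 0ℤ 1ℤ) (at-0,1 A′ B′ C′))
  a+b+c≡ : A + B + C ≡ A′ + B′ + C′
  a+b+c≡ = trans (sym (at-1,1 A B C)) (trans (g≗h 1ℤ 1ℤ) (at-1,1 A′ B′ C′))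
  b≡ : B ≡ B′
  b≡ = begin
    B                        ≡⟨ middle A B C ⟩
    A + B + C - A - C        ≡⟨ cong (λ s → s - A - C) a+b+c≡ ⟩
    A′ + B′ + C′ - A - C     ≡⟨ cong₂ (λ u v → A′ + B′ + C′ - u - v) a≡ c≡ ⟩
    A′ + B′ + C′ - A′ - C′   ≡⟨ middle A′ B′ C′ ⟨
    B′                       ∎
    where
    open ≡-Reasoning
    middle : ∀ A B C → B ≡ A + B + C - A - C
    middle = solve-∀

≈F⇒· : ∀ {g f} → g ≈F f → Σ SL₂ λ M → g ≡ f · M
≈F⇒· {g} {f} (α , β , γ , δ , det≡1 , g≗f∘M) =
  M , form-ext (λ x y → trans (g≗f∘M x y) (sym (eval-· f M x y)))
  where
  M = sl₂ α β γ δ det≡1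

translation : ℤ → SL₂
translation k = sl₂ 1ℤ k 0ℤ 1ℤ (unimodular k)
  where
  unimodular : ∀ k → 1ℤ * 1ℤ - k * 0ℤ ≡ 1ℤ
  unimodular = solve-∀

square-nonneg : ∀ z → 0ℤ ≤ z * z
square-nonneg (+ n) = subst (0ℤ ≤_) (ℤ.pos-* n n) (+≤+ z≤n)
square-nonneg -[1+ n ] = +≤+ z≤n

disc<0⇒a≢0 : ∀ f → disc f < 0ℤ → a f ≢ 0ℤ
disc<0⇒a≢0 (form A B C) D<0 refl = ℤ.<⇒≱ D<0 (subst (0ℤ ≤_) (disc-at-0 B C) (square-nonneg B))
  where
  disc-at-0 : ∀ B C → B * B ≡ B * B - + 4 * 0ℤ * C
  disc-at-0 = solve-∀

disc-determines-c : ∀ {A B C C′} → A ≢ 0ℤ → disc (form A B C) ≡ disc (form A B C′) → C ≡ C′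
disc-determines-c {A} {B} {C} {C′} A≢0 disc≡ =
  ℤ.*-cancelˡ-≡ (+ 4) C C′ (ℤ.*-cancelˡ-≡ A (+ 4 * C) (+ 4 * C′) {{≢-nonZero A≢0}} (begin
    A * (+ 4 * C)                  ≡⟨ isolate B A C ⟩
    B * B - disc (form A B C)      ≡⟨ cong (_-_ (B * B)) disc≡ ⟩
    B * B - disc (form A B C′)     ≡⟨ isolate B A C′ ⟨
    A * (+ 4 * C′)                 ∎))
  where
  open ≡-Reasoning
  isolate : ∀ B A C → A * (+ 4 * C) ≡ B * B - (B * B - + 4 * A * C)
  isolate = solve-∀

translate : ∀ f {B C} k → a f ≢ 0ℤ → B - b f ≡ k * (+ 2 * a f) → disc (form (a f) B C) ≡ disc f →
            form (a f) B C ≡ f · translation k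
translate f@(form A B₁ C₁) {B} {C} k A≢0 B-B₁≡ disc≡ = trans (cong (form A B) C≡) (sym f·T≡)
  where
  a-part : ∀ A B C → A * 1ℤ * 1ℤ + B * 1ℤ * 0ℤ + C * 0ℤ * 0ℤ ≡ A
  a-part = solve-∀
  b-part : ∀ A B₁ C₁ k B →
    + 2 * A * 1ℤ * k + B₁ * (1ℤ * 1ℤ + k * 0ℤ) + + 2 * C₁ * 0ℤ * 1ℤ ≡ B - (B - B₁ - k * (+ 2 * A))
  b-part = solve-∀
  b-back : ∀ B e → B - (e - e) ≡ B
  b-back = solve-∀
  f·T≡ : f · translation k ≡ form A B (eval f k 1ℤ)
  f·T≡ = form-≡ (a-part A B₁ C₁) (begin
    + 2 * A * 1ℤ * k + B₁ * (1ℤ * 1ℤ + k * 0ℤ) + + 2 * C₁ * 0ℤ * 1ℤ  ≡⟨ b-part A B₁ C₁ k B ⟩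
    B - (B - B₁ - k * (+ 2 * A))                                      ≡⟨ cong (λ e → B - (e - k * (+ 2 * A))) B-B₁≡ ⟩
    B - (k * (+ 2 * A) - k * (+ 2 * A))                               ≡⟨ b-back B (k * (+ 2 * A)) ⟩
    B                                                                 ∎) refl
    where open ≡-Reasoning
  C≡ : C ≡ eval f k 1ℤ
  C≡ = disc-determines-c {B = B} A≢0 (trans disc≡ (trans (sym (disc-· f (translation k))) (cong disc f·T≡)))

-- (x , y) is an eigenvector mod q, with eigenvalue ρ, of (-b , -2c ; 2a , b), the matrix of
-- multiplication by √D on the lattice.
Label : ℤ → Form → ℤ → ℤ → ℤ → Set
Label q f ρ x y = q ∣ - b f * x - + 2 * c f * y - ρ * x × q ∣ + 2 * a f * x + b f * y - ρ * y

record LabelledRep (q : ℤ) (f : Form) (ρ m : ℤ) : Set where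
  constructor labelled
  field
    x y : ℤ
    represents : eval f x y ≡ m
    label : Label q f ρ x y

label-· : ∀ f M {q ρ x y} → let open SL₂ M in
          Label q f ρ (α * x + β * y) (γ * x + δ * y) → Label q (f · M) ρ x y
label-· (form A B C) (sl₂ α β γ δ det≡1) {q} {ρ} {x} {y} (q∣first , q∣second) =
  ∣-linear₃ δ (- β) (ρ * x) (first A B C α β γ δ ρ x y) q∣first q∣second q∣det-1 ,
  ∣-linear₃ (- γ) α (ρ * y) (second A B C α β γ δ ρ x y) q∣first q∣second q∣det-1
  where
  q∣det-1 : q ∣ α * δ - β * γ - 1ℤ
  q∣det-1 = divides 0ℤ (cong (_- 1ℤ) det≡1)
  first : ∀ A B C α β γ δ ρ x y →
    - (+ 2 * A * α * β + B * (α * δ + β * γ) + + 2 * C * γ * δ) * x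
      - + 2 * (A * β * β + B * β * δ + C * δ * δ) * y - ρ * x
    ≡ δ * (- B * (α * x + β * y) - + 2 * C * (γ * x + δ * y) - ρ * (α * x + β * y))
      + - β * (+ 2 * A * (α * x + β * y) + B * (γ * x + δ * y) - ρ * (γ * x + δ * y))
      + ρ * x * (α * δ - β * γ - 1ℤ)
  first = solve-∀
  second : ∀ A B C α β γ δ ρ x y →
    + 2 * (A * α * α + B * α * γ + C * γ * γ) * x
      + (+ 2 * A * α * β + B * (α * δ + β * γ) + + 2 * C * γ * δ) * y - ρ * y
    ≡ - γ * (- B * (α * x + β * y) - + 2 * C * (γ * x + δ * y) - ρ * (α * x + β * y))
      + α * (+ 2 * A * (α * x + β * y) + B * (γ * x + δ * y) - ρ * (γ * x + δ * y))
      + ρ * y * (α * δ - β * γ - 1ℤ)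
  second = solve-∀

pullback : ∀ f M {q ρ m} → LabelledRep q f ρ m → LabelledRep q (f · M) ρ m
pullback f M@(sl₂ α β γ δ det≡1) {q} {ρ} (labelled x y fxy≡m label) = labelled x′ y′
  (trans (eval-· f M x′ y′) (subst₂ (λ u v → eval f u v ≡ _) (sym Mv′≡x) (sym Mv′≡y) fxy≡m))
  (label-· f M {q} {ρ} (subst₂ (Label q f ρ) (sym Mv′≡x) (sym Mv′≡y) label))
  where
  x′ = δ * x - β * y
  y′ = - γ * x + α * y
  first : ∀ α β γ δ x y → α * (δ * x - β * y) + β * (- γ * x + α * y) ≡ (α * δ - β * γ) * x
  first = solve-∀
  second : ∀ α β γ δ x y → γ * (δ * x - β * y) + δ * (- γ * x + α * y) ≡ (α * δ - β * γ) * y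
  second = solve-∀
  Mv′≡x : α * x′ + β * y′ ≡ x
  Mv′≡x = trans (first α β γ δ x y) (trans (cong (_* x) det≡1) (ℤ.*-identityˡ x))
  Mv′≡y : γ * x′ + δ * y′ ≡ y
  Mv′≡y = trans (second α β γ δ x y) (trans (cong (_* y) det≡1) (ℤ.*-identityˡ y))

-- Dirichlet composition of the united forms (a₁ , B , a₂ C) and (a₂ , B , a₁ C).
eval-composition : ∀ a₁ a₂ B C x₁ y₁ x₂ y₂ →
  eval (form (a₁ * a₂) B C)
       (x₁ * x₂ - C * y₁ * y₂) (a₁ * x₁ * y₂ + a₂ * x₂ * y₁ + B * y₁ * y₂)
  ≡ eval (form a₁ B (a₂ * C)) x₁ y₁ * eval (form a₂ B (a₁ * C)) x₂ y₂
eval-composition = identity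
  where
  identity : ∀ a₁ a₂ B C x₁ y₁ x₂ y₂ →
    (a₁ * a₂) * (x₁ * x₂ - C * y₁ * y₂) * (x₁ * x₂ - C * y₁ * y₂)
      + B * (x₁ * x₂ - C * y₁ * y₂) * (a₁ * x₁ * y₂ + a₂ * x₂ * y₁ + B * y₁ * y₂)
      + C * (a₁ * x₁ * y₂ + a₂ * x₂ * y₁ + B * y₁ * y₂) * (a₁ * x₁ * y₂ + a₂ * x₂ * y₁ + B * y₁ * y₂)
    ≡ (a₁ * x₁ * x₁ + B * x₁ * y₁ + (a₂ * C) * y₁ * y₁)
      * (a₂ * x₂ * x₂ + B * x₂ * y₂ + (a₁ * C) * y₂ * y₂)
  identity = solve-∀

translate-labelled : ∀ f {B C q ρ m} → disc f < 0ℤ → (+ 2 * a f) ∣ B - b f →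
  disc (form (a f) B C) ≡ disc f → LabelledRep q f ρ m → LabelledRep q (form (a f) B C) ρ m
translate-labelled f {B} {C} {q} {ρ} {m} D<0 (divides k B-b≡) disc≡ rep =
  subst (λ g → LabelledRep q g ρ m) (sym (translate f {B} {C} k (disc<0⇒a≢0 f D<0) B-b≡ disc≡))
        (pullback f (translation k) rep)

disc-factor : ∀ h {a₁ a₂} → a h ≡ a₁ * a₂ → disc (form a₁ (b h) (a₂ * c h)) ≡ disc h
disc-factor (form A B C) {a₁} {a₂} refl = regroup a₁ a₂ B C
  where
  regroup : ∀ a₁ a₂ B C → B * B - + 4 * a₁ * (a₂ * C) ≡ B * B - + 4 * (a₁ * a₂) * C
  regroup = solve-∀

≈F⇒disc≡ : ∀ {g f} → g ≈F f → disc g ≡ disc f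
≈F⇒disc≡ {g} {f} g≈f =
  let (M , g≡f·M) = ≈F⇒· {g} {f} g≈f in trans (cong disc g≡f·M) (disc-· f M)

pullback-≈F : ∀ {g f q ρ m} → g ≈F f → LabelledRep q f ρ m → LabelledRep q g ρ m
pullback-≈F {g} {f} {q} {ρ} {m} g≈f rep =
  let (M , g≡f·M) = ≈F⇒· {g} {f} g≈f in subst (λ g′ → LabelledRep q g′ ρ m) (sym g≡f·M) (pullback f M rep)

module AmbiguousSquare (p : ℕ) (p-prime : Prime p) where
  open ModPrime p p-prime

  -- q = p for odd p and q = 4 for p = 2: the modulus at which labels are taken, chosen so that
  -- the two square roots ±ρ of D remain distinct.
  record LabelModulus (q D : ℤ) : Set where
    field
      q∣P² : q ∣ P * P
      q∣2P : q ∣ + 2 * P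
      halve : ∀ {z} → q ∣ + 2 * z → P ∣ z
      roots-distinct : ∀ {ρ} → q ∣ D - ρ * ρ → ¬ q ∣ + 2 * ρ

  module Labels {q D : ℤ} (Q : LabelModulus q D) where
    open LabelModulus Q

    P∣z⇒q∣2z : ∀ {z} → P ∣ z → q ∣ + 2 * z
    P∣z⇒q∣2z (divides r refl) = ∣-linear₁ r (regroup r P) q∣2P
      where
      regroup : ∀ r P → + 2 * (r * P) ≡ r * (+ 2 * P)
      regroup = solve-∀

    label-exists : ∀ f {x y} → eval f x y ≡ P → ∃[ ρ ] Label q f ρ x y
    label-exists f@(form A B C) {x} {y} fxy≡P =
      proportional q∣P² (represents-P⇒primitive f fxy≡P)
        (subst (q ∣_) (trans (cong (+ 2 *_) (sym fxy≡P)) (sym (twice-form A B C x y))) q∣2P)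
      where
      twice-form : ∀ A B C x y → x * (+ 2 * A * x + B * y) - y * (- B * x - + 2 * C * y)
                                 ≡ + 2 * (A * x * x + B * x * y + C * y * y)
      twice-form = solve-∀

    label²≡disc : ∀ f {ρ x y} → Label q f ρ x y → p-Primitive x y → q ∣ disc f - ρ * ρ
    label²≡disc (form A B C) {ρ} {x} {y} (q∣first , q∣second) prim = cancel-primitive q∣P² prim
      (∣-linear₂ (ρ - B) (- (+ 2 * C)) (at-x A B C ρ x y) q∣first q∣second)
      (∣-linear₂ (+ 2 * A) (B + ρ) (at-y A B C ρ x y) q∣first q∣second)
      where
      at-x : ∀ A B C ρ x y → (B * B - + 4 * A * C - ρ * ρ) * x
        ≡ (ρ - B) * (- B * x - + 2 * C * y - ρ * x) + - (+ 2 * C) * (+ 2 * A * x + B * y - ρ * y)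
      at-x = solve-∀
      at-y : ∀ A B C ρ x y → (B * B - + 4 * A * C - ρ * ρ) * y
        ≡ (+ 2 * A) * (- B * x - + 2 * C * y - ρ * x) + (B + ρ) * (+ 2 * A * x + B * y - ρ * y)
      at-y = solve-∀

    private
      -- If the composed vector were divisible by p with p ∣ y₁, the two labels would force
      -- both B + ρ and B - ρ to vanish mod q.
      degenerate-side : ∀ {a₂ B C ρ x₁ y₁ x₂ y₂} → ¬ q ∣ + 2 * ρ →
        p-Primitive x₁ y₁ → p-Primitive x₂ y₂ →
        q ∣ - B * x₁ - + 2 * (a₂ * C) * y₁ - ρ * x₁ → q ∣ + 2 * a₂ * x₂ + B * y₂ - ρ * y₂ →
        P ∣ x₁ * x₂ → P ∣ y₁ → ⊥
      degenerate-side {a₂} {B} {C} {ρ} {x₁} {y₁} {x₂} {y₂}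
                      q∤2ρ prim₁ prim₂ q∣label₁ q∣label₂ P∣x₁x₂ P∣y₁ =
        q∤2ρ (∣-linear₂ 1ℤ (- 1ℤ) (difference B ρ) q∣B+ρ q∣B-ρ)
        where
        difference : ∀ B ρ → + 2 * ρ ≡ 1ℤ * (B + ρ) + - 1ℤ * (B - ρ)
        difference = solve-∀
        plus-side : ∀ a₂ B C ρ x₁ y₁ → (B + ρ) * x₁
          ≡ - 1ℤ * (- B * x₁ - + 2 * (a₂ * C) * y₁ - ρ * x₁) + - 1ℤ * (+ 2 * (a₂ * C * y₁))
        plus-side = solve-∀
        minus-side : ∀ a₂ B ρ x₂ y₂ → (B - ρ) * y₂
          ≡ 1ℤ * (+ 2 * a₂ * x₂ + B * y₂ - ρ * y₂) + - 1ℤ * (+ 2 * (a₂ * x₂))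
        minus-side = solve-∀
        P∤x₁ : ¬ P ∣ x₁
        P∤x₁ P∣x₁ = prim₁ (P∣x₁ , P∣y₁)
        P∣x₂ : P ∣ x₂
        P∣x₂ = [ ⊥-elim ∘ P∤x₁ , id ]′ (P∣xy⇒P∣x⊎P∣y x₁ x₂ P∣x₁x₂)
        q∣B+ρ : q ∣ B + ρ
        q∣B+ρ = cancel q∣P² (∣-linear₂ (- 1ℤ) (- 1ℤ) (plus-side a₂ B C ρ x₁ y₁) q∣label₁
                  (P∣z⇒q∣2z (∣n⇒∣m*n (a₂ * C) P∣y₁))) P∤x₁
        q∣B-ρ : q ∣ B - ρ
        q∣B-ρ = cancel q∣P² (∣-linear₂ 1ℤ (- 1ℤ) (minus-side a₂ B ρ x₂ y₂) q∣label₂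
                  (P∣z⇒q∣2z (∣n⇒∣m*n a₂ P∣x₂))) (λ P∣y₂ → prim₂ (P∣x₂ , P∣y₂))

    compose-labelled : ∀ {a₁ a₂ B C ρ} → ¬ q ∣ + 2 * ρ →
      LabelledRep q (form a₁ B (a₂ * C)) ρ P → LabelledRep q (form a₂ B (a₁ * C)) ρ P →
      ∃[ u₁ ] ∃[ u₂ ] (eval (form (a₁ * a₂) B C) u₁ u₂ ≡ P * P × p-Primitive u₁ u₂)
    -- The labels give 2ρ y₁ y₂ ≡ 2Y (mod q), so p ∣ X, Y would force p ∣ ρ, p ∣ y₁ or p ∣ y₂.
    compose-labelled {a₁} {a₂} {B} {C} {ρ} q∤2ρ
                     (labelled x₁ y₁ r₁ (e₁ , e₂)) (labelled x₂ y₂ r₂ (e₃ , e₄)) =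
      X , Y , trans (eval-composition a₁ a₂ B C x₁ y₁ x₂ y₂) (cong₂ _*_ r₁ r₂) , X,Y-primitive
      where
      X = x₁ * x₂ - C * y₁ * y₂
      Y = a₁ * x₁ * y₂ + a₂ * x₂ * y₁ + B * y₁ * y₂
      prim₁ = represents-P⇒primitive (form a₁ B (a₂ * C)) r₁
      prim₂ = represents-P⇒primitive (form a₂ B (a₁ * C)) r₂
      from-labels : ∀ a₁ a₂ B ρ x₁ y₁ x₂ y₂ → + 2 * (ρ * y₁ * y₂)
        ≡ 1ℤ * (+ 2 * (a₁ * x₁ * y₂ + a₂ * x₂ * y₁ + B * y₁ * y₂))
          + - y₂ * (+ 2 * a₁ * x₁ + B * y₁ - ρ * y₁) + - y₁ * (+ 2 * a₂ * x₂ + B * y₂ - ρ * y₂)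
      from-labels = solve-∀
      first-coordinate : ∀ x₁ x₂ C y₁ y₂ →
        x₁ * x₂ ≡ 1ℤ * (x₁ * x₂ - C * y₁ * y₂) + 1ℤ * (C * y₁ * y₂)
      first-coordinate = solve-∀
      P∣x₁x₂ : P ∣ X → P ∣ C * y₁ * y₂ → P ∣ x₁ * x₂
      P∣x₁x₂ = ∣-linear₂ 1ℤ 1ℤ (first-coordinate x₁ x₂ C y₁ y₂)
      P∣ρy₁y₂ : P ∣ Y → P ∣ ρ * y₁ * y₂
      P∣ρy₁y₂ P∣Y =
        halve (∣-linear₃ 1ℤ (- y₂) (- y₁) (from-labels a₁ a₂ B ρ x₁ y₁ x₂ y₂) (P∣z⇒q∣2z P∣Y) e₂ e₄)
      X,Y-primitive : p-Primitive X Y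
      X,Y-primitive (P∣X , P∣Y) =
        [ P∣ρy₁-case , P∣y₂-case ]′ (P∣xy⇒P∣x⊎P∣y (ρ * y₁) y₂ (P∣ρy₁y₂ P∣Y))
        where
        P∣y₁-case : P ∣ y₁ → ⊥
        P∣y₁-case P∣y₁ = degenerate-side {a₂} {B} {C} {ρ} {x₁} {y₁} {x₂} {y₂} q∤2ρ prim₁ prim₂ e₁ e₄
          (P∣x₁x₂ P∣X (∣m⇒∣m*n y₂ (∣n⇒∣m*n C P∣y₁))) P∣y₁
        P∣y₂-case : P ∣ y₂ → ⊥
        P∣y₂-case P∣y₂ = degenerate-side {a₁} {B} {C} {ρ} {x₂} {y₂} {x₁} {y₁} q∤2ρ prim₂ prim₁ e₃ e₂
          (subst (P ∣_) (ℤ.*-comm x₁ x₂) (P∣x₁x₂ P∣X (∣n⇒∣m*n (C * y₁) P∣y₂))) P∣y₂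
        P∣ρy₁-case : P ∣ ρ * y₁ → ⊥
        P∣ρy₁-case P∣ρy₁ = [ q∤2ρ ∘ P∣z⇒q∣2z , P∣y₁-case ]′ (P∣xy⇒P∣x⊎P∣y ρ y₁ P∣ρy₁)

  principal-primitive : ∀ {h b₀ c₀ u₁ u₂} → h ≈F form 1ℤ b₀ c₀ →
    eval h u₁ u₂ ≡ P * P → p-Primitive u₁ u₂ → ∃[ s ] ∃[ t ] (eval (form 1ℤ b₀ c₀) s t ≡ P * P × ¬ P ∣ t)
  principal-primitive {b₀ = b₀} {c₀} {u₁} {u₂} (α , β , γ , δ , det≡1 , h≗) rep prim =
    s , t , rep′ , P∤t
    where
    s = α * u₁ + β * u₂
    t = γ * u₁ + δ * u₂
    rep′ : eval (form 1ℤ b₀ c₀) s t ≡ P * P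
    rep′ = trans (sym (h≗ u₁ u₂)) rep
    square : ∀ b₀ c₀ s t →
      s * s ≡ 1ℤ * (1ℤ * s * s + b₀ * s * t + c₀ * t * t) + - (b₀ * s) * t + - (c₀ * t) * t
    square = solve-∀
    invert₁ : ∀ α β γ δ u₁ u₂ →
      u₁ ≡ δ * (α * u₁ + β * u₂) + - β * (γ * u₁ + δ * u₂) + - u₁ * (α * δ - β * γ - 1ℤ)
    invert₁ = solve-∀
    invert₂ : ∀ α β γ δ u₁ u₂ →
      u₂ ≡ - γ * (α * u₁ + β * u₂) + α * (γ * u₁ + δ * u₂) + - u₂ * (α * δ - β * γ - 1ℤ)
    invert₂ = solve-∀
    P∣det-1 : P ∣ α * δ - β * γ - 1ℤ
    P∣det-1 = divides 0ℤ (cong (_- 1ℤ) det≡1)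
    P∣norm : P ∣ eval (form 1ℤ b₀ c₀) s t
    P∣norm = subst (P ∣_) (sym rep′) (divides P refl)
    P∤t : ¬ P ∣ t
    P∤t P∣t = prim (∣-linear₃ δ (- β) (- u₁) (invert₁ α β γ δ u₁ u₂) P∣s P∣t P∣det-1 ,
                    ∣-linear₃ (- γ) α (- u₂) (invert₂ α β γ δ u₁ u₂) P∣s P∣t P∣det-1)
      where
      P∣s : P ∣ s
      P∣s = P∣x²⇒P∣x (∣-linear₃ 1ℤ (- (b₀ * s)) (- (c₀ * t)) (square b₀ c₀ s t) P∣norm P∣t P∣t)

  record PrincipalRepresentsP² (D : ℤ) : Set where
    field
      b₀ c₀ s t : ℤ
      disc≡ : disc (form 1ℤ b₀ c₀) ≡ D
      represents : eval (form 1ℤ b₀ c₀) s t ≡ P * P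
      P∤t : ¬ P ∣ t

  module _ {q D : ℤ} (Q : LabelModulus q D) (D<0 : D < 0ℤ) where
    open Labels Q

    PrimitiveRepOfP² : Form → Set
    PrimitiveRepOfP² h = ∃[ u₁ ] ∃[ u₂ ] (eval h u₁ u₂ ≡ P * P × p-Primitive u₁ u₂)

    composite-rep : ∀ {g₁ g₂ h ρ} → disc g₁ ≡ D → DirichletComp g₁ g₂ h → ¬ q ∣ + 2 * ρ →
      LabelledRep q g₁ ρ P → LabelledRep q g₂ ρ P → PrimitiveRepOfP² h
    composite-rep {g₁} {g₂} {h} {ρ} refl (disc₁≡disc₂ , _ , a-h≡ , disc-h≡ , 2a₁∣ , 2a₂∣) q∤2ρ rep₁ rep₂ =
      subst (λ A → PrimitiveRepOfP² (form A (b h) (c h))) (sym a-h≡)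
        (compose-labelled {a g₁} {a g₂} {b h} {c h} {ρ} q∤2ρ
          (translate-labelled g₁ {b h} {a g₂ * c h} D<0 (∣ᵤ⇒∣ {+ 2 * a g₁} {b h - b g₁} 2a₁∣)
            (trans (disc-factor h {a g₁} {a g₂} a-h≡) disc-h≡) rep₁)
          (translate-labelled g₂ {b h} {a g₁ * c h} (subst (_< 0ℤ) disc₁≡disc₂ D<0)
            (∣ᵤ⇒∣ {+ 2 * a g₂} {b h - b g₂} 2a₂∣)
            (trans (disc-factor h {a g₂} {a g₁} (trans a-h≡ (ℤ.*-comm (a g₁) (a g₂))))
                   (trans disc-h≡ disc₁≡disc₂)) rep₂))

    labelled-root : ∀ {g} → disc g ≡ D → Represents g P → ∃[ ρ ] (¬ q ∣ + 2 * ρ × LabelledRep q g ρ P)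
    labelled-root {g} disc≡ (x , y , r) = ρ , q∤2ρ , labelled x y r label
      where
      ρ = proj₁ (label-exists g {x} {y} r)
      label = proj₂ (label-exists g {x} {y} r)
      q∤2ρ : ¬ q ∣ + 2 * ρ
      q∤2ρ = LabelModulus.roots-distinct Q
        (subst (λ D′ → q ∣ D′ - ρ * ρ) disc≡
          (label²≡disc g {ρ} {x} {y} label (represents-P⇒primitive g {x} {y} r)))

    ambiguous-square : ∀ {g} → disc g ≡ D → Ambiguous g → Represents g P → PrincipalRepresentsP² D
    ambiguous-square {g} disc-g≡D
      (g₁ , g₂ , h , g₁≈g , g₂≈g , comp@(_ , _ , _ , disc-h≡ , _) , b₀ , c₀ , disc₀≡ , h≈principal) g-rep =
      principal (composite-rep {g₁} {g₂} {h} {ρ} disc-g₁≡D comp q∤2ρ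
                  (pullback-≈F {g₁} {g} g₁≈g rep) (pullback-≈F {g₂} {g} g₂≈g rep))
      where
      root = labelled-root {g} disc-g≡D g-rep
      ρ = proj₁ root
      q∤2ρ = proj₁ (proj₂ root)
      rep = proj₂ (proj₂ root)
      disc-g₁≡D : disc g₁ ≡ D
      disc-g₁≡D = trans (≈F⇒disc≡ {g₁} {g} g₁≈g) disc-g≡D
      principal : PrimitiveRepOfP² h → PrincipalRepresentsP² D
      principal (u₁ , u₂ , h-rep , prim) =
        let (s , t , principal-rep , P∤t) =
              principal-primitive {h} {b₀} {c₀} {u₁} {u₂} h≈principal h-rep prim
        in record { b₀ = b₀ ; c₀ = c₀ ; s = s ; t = t ; disc≡ = trans disc₀≡ (trans disc-h≡ disc-g₁≡D)
                  ; represents = principal-rep ; P∤t = P∤t }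

-- ℓ = (A , b₀ + 2k , C) is a module over the order of the principal form (1 , b₀ , c₀):
-- ω, a root of X² + b₀ X + c₀, acts by the matrix (-(b₀ + k) , -C ; A , k), and
-- u + v ω acts by (act₁ u v , act₂ u v).
module OrderAction (p : ℕ) (p-prime : Prime p) (A b₀ k C : ℤ) where
  open ModPrime p p-prime

  ℓ : Form
  ℓ = form A (b₀ + + 2 * k) C

  c₀ : ℤ
  c₀ = A * C - b₀ * k - k * k

  act₁ act₂ : ℤ → ℤ → ℤ → ℤ → ℤ
  act₁ u v x y = u * x + v * (- (b₀ + k) * x - C * y)
  act₂ u v x y = u * y + v * (A * x + k * y)

  norm : ℤ → ℤ → ℤ
  norm u v = u * u - b₀ * u * v + c₀ * v * v

  Eigen : ℤ → ℤ → ℤ → ℤ → ℤ → ℤ → Set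
  Eigen q u v μ x y = q ∣ act₁ u v x y - μ * x × q ∣ act₂ u v x y - μ * y

  -- (u - b₀ v) - v ω is the conjugate of u + v ω.
  norm-conj : ∀ u v → norm (u - b₀ * v) (- v) ≡ norm u v
  norm-conj = identity A b₀ k C
    where
    identity : ∀ A b₀ k C u v →
      (u - b₀ * v) * (u - b₀ * v) - b₀ * (u - b₀ * v) * - v + (A * C - b₀ * k - k * k) * - v * - v
      ≡ u * u - b₀ * u * v + (A * C - b₀ * k - k * k) * v * v
    identity = solve-∀

  eval-act : ∀ u v x y → eval ℓ (act₁ u v x y) (act₂ u v x y) ≡ norm u v * eval ℓ x y
  eval-act = identity A b₀ k C
    where
    identity : ∀ A b₀ k C u v x y →
      A * (u * x + v * (- (b₀ + k) * x - C * y)) * (u * x + v * (- (b₀ + k) * x - C * y))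
        + (b₀ + + 2 * k) * (u * x + v * (- (b₀ + k) * x - C * y)) * (u * y + v * (A * x + k * y))
        + C * (u * y + v * (A * x + k * y)) * (u * y + v * (A * x + k * y))
      ≡ (u * u - b₀ * u * v + (A * C - b₀ * k - k * k) * v * v)
        * (A * x * x + (b₀ + + 2 * k) * x * y + C * y * y)
    identity = solve-∀

  det-act : ∀ u v x y → x * act₂ u v x y - y * act₁ u v x y ≡ v * eval ℓ x y
  det-act = identity A b₀ k C
    where
    identity : ∀ A b₀ k C u v x y →
      x * (u * y + v * (A * x + k * y)) - y * (u * x + v * (- (b₀ + k) * x - C * y))
      ≡ v * (A * x * x + (b₀ + + 2 * k) * x * y + C * y * y)
    identity = solve-∀

  act-scaled : ∀ u v x y m →
    act₁ u v (x * m) (y * m) ≡ act₁ u v x y * m × act₂ u v (x * m) (y * m) ≡ act₂ u v x y * m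
  act-scaled u v x y m = scaled₁ A b₀ k C u v x y m , scaled₂ A b₀ k C u v x y m
    where
    scaled₁ : ∀ A b₀ k C u v x y m →
      u * (x * m) + v * (- (b₀ + k) * (x * m) - C * (y * m)) ≡ (u * x + v * (- (b₀ + k) * x - C * y)) * m
    scaled₁ = solve-∀
    scaled₂ : ∀ A b₀ k C u v x y m →
      u * (y * m) + v * (A * (x * m) + k * (y * m)) ≡ (u * y + v * (A * x + k * y)) * m
    scaled₂ = solve-∀

  act-conj : ∀ u v x y → let x′ = act₁ u v x y ; y′ = act₂ u v x y in
    act₁ (u - b₀ * v) (- v) x′ y′ ≡ norm u v * x × act₂ (u - b₀ * v) (- v) x′ y′ ≡ norm u v * y
  act-conj u v x y = conj₁ A b₀ k C u v x y , conj₂ A b₀ k C u v x y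
    where
    conj₁ : ∀ A b₀ k C u v x y →
      (u - b₀ * v) * (u * x + v * (- (b₀ + k) * x - C * y))
        + - v * (- (b₀ + k) * (u * x + v * (- (b₀ + k) * x - C * y)) - C * (u * y + v * (A * x + k * y)))
      ≡ (u * u - b₀ * u * v + (A * C - b₀ * k - k * k) * v * v) * x
    conj₁ = solve-∀
    conj₂ : ∀ A b₀ k C u v x y →
      (u - b₀ * v) * (u * y + v * (A * x + k * y))
        + - v * (A * (u * x + v * (- (b₀ + k) * x - C * y)) + k * (u * y + v * (A * x + k * y)))
      ≡ (u * u - b₀ * u * v + (A * C - b₀ * k - k * k) * v * v) * y
    conj₂ = solve-∀

  P²∣eigenvalue⇒P²∣act : ∀ {u v μ x y} → Eigen (P * P) u v μ x y → P * P ∣ μ →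
    P * P ∣ act₁ u v x y × P * P ∣ act₂ u v x y
  P²∣eigenvalue⇒P²∣act {u} {v} {μ} {x} {y} (e₁ , e₂) P²∣μ =
    ∣-linear₂ 1ℤ x (add-back (act₁ u v x y) μ x) e₁ P²∣μ ,
    ∣-linear₂ 1ℤ y (add-back (act₂ u v x y) μ y) e₂ P²∣μ
    where
    add-back : ∀ a μ x → a ≡ 1ℤ * (a - μ * x) + x * μ
    add-back = solve-∀

  -- The trace T = 2u - b₀v satisfies T² - D v² = 4 p², so p ∣ T would give p ∣ D v².
  eigenvalues-not-both-divisible : ∀ {u v μ μ̄} → norm u v ≡ P * P → ¬ P ∣ v → ¬ P ∣ disc ℓ →
    P * P ∣ + 2 * u - b₀ * v - μ - μ̄ → P ∣ μ → P ∣ μ̄ → ⊥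
  eigenvalues-not-both-divisible {u} {v} {μ} {μ̄} norm≡ P∤v P∤D P²∣T-μ-μ̄ P∣μ P∣μ̄ =
    [ [ P∤D , P∤v ]′ ∘ P∣xy⇒P∣x⊎P∣y (disc ℓ) v , P∤v ]′ (P∣xy⇒P∣x⊎P∣y (disc ℓ * v) v P∣Dvv)
    where
    T = + 2 * u - b₀ * v
    recombine : ∀ T μ μ̄ → T ≡ 1ℤ * (T - μ - μ̄) + 1ℤ * μ + 1ℤ * μ̄
    recombine = solve-∀
    trace² : ∀ A b₀ k C u v → ((b₀ + + 2 * k) * (b₀ + + 2 * k) - + 4 * A * C) * v * v
      ≡ (+ 2 * u - b₀ * v) * (+ 2 * u - b₀ * v)
        + - + 4 * (u * u - b₀ * u * v + (A * C - b₀ * k - k * k) * v * v)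
    trace² = solve-∀
    P∣T : P ∣ T
    P∣T = ∣-linear₃ 1ℤ 1ℤ 1ℤ (recombine T μ μ̄) (∣-trans (divides P refl) P²∣T-μ-μ̄) P∣μ P∣μ̄
    P∣Dvv : P ∣ disc ℓ * v * v
    P∣Dvv = ∣-linear₂ T (- + 4) (trace² A b₀ k C u v) P∣T (subst (P ∣_) (sym norm≡) (divides P refl))

  module _ {N x y : ℤ} (rep : eval ℓ x y ≡ N * (P * P)) (prim : p-Primitive x y) where

    eigenvector : ∀ u v → ∃[ μ ] Eigen (P * P) u v μ x y
    eigenvector u v = proportional ∣-refl prim
      (subst (P * P ∣_) (sym (trans (det-act u v x y) (cong (v *_) rep))) (∣n⇒∣m*n v (divides N refl)))

    eigenvalue-product : ∀ {u v μ μ̄} → norm u v ≡ P * P →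
      Eigen (P * P) u v μ x y → Eigen (P * P) (u - b₀ * v) (- v) μ̄ x y → P * P ∣ μ * μ̄
    eigenvalue-product {u} {v} {μ} {μ̄} norm≡ (e₁ , e₂) (ē₁ , ē₂) = cancel-primitive ∣-refl prim
      (∣-linear₄ x (- (u + v * k)) (- (v * C)) (- μ) (at-x A b₀ k C u v μ μ̄ x y) P²∣norm e₁ e₂ ē₁)
      (∣-linear₄ y (v * A) (- (u - b₀ * v - v * k)) (- μ) (at-y A b₀ k C u v μ μ̄ x y) P²∣norm e₁ e₂ ē₂)
      where
      P²∣norm : P * P ∣ norm u v
      P²∣norm = subst (P * P ∣_) (sym norm≡) ∣-refl
      at-x : ∀ A b₀ k C u v μ μ̄ x y → μ * μ̄ * x
        ≡ x * (u * u - b₀ * u * v + (A * C - b₀ * k - k * k) * v * v)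
          + - (u + v * k) * (u * x + v * (- (b₀ + k) * x - C * y) - μ * x)
          + - (v * C) * (u * y + v * (A * x + k * y) - μ * y)
          + - μ * ((u - b₀ * v) * x + - v * (- (b₀ + k) * x - C * y) - μ̄ * x)
      at-x = solve-∀
      at-y : ∀ A b₀ k C u v μ μ̄ x y → μ * μ̄ * y
        ≡ y * (u * u - b₀ * u * v + (A * C - b₀ * k - k * k) * v * v)
          + v * A * (u * x + v * (- (b₀ + k) * x - C * y) - μ * x)
          + - (u - b₀ * v - v * k) * (u * y + v * (A * x + k * y) - μ * y)
          + - μ * ((u - b₀ * v) * y + - v * (A * x + k * y) - μ̄ * y)
      at-y = solve-∀

    eigenvalue-sum : ∀ {u v μ μ̄} →
      Eigen (P * P) u v μ x y → Eigen (P * P) (u - b₀ * v) (- v) μ̄ x y →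
      P * P ∣ + 2 * u - b₀ * v - μ - μ̄
    eigenvalue-sum {u} {v} {μ} {μ̄} (e₁ , e₂) (ē₁ , ē₂) = cancel-primitive ∣-refl prim
      (∣-linear₂ 1ℤ 1ℤ (at-x A b₀ k C u v μ μ̄ x y) e₁ ē₁)
      (∣-linear₂ 1ℤ 1ℤ (at-y A b₀ k C u v μ μ̄ x y) e₂ ē₂)
      where
      at-x : ∀ A b₀ k C u v μ μ̄ x y → (+ 2 * u - b₀ * v - μ - μ̄) * x
        ≡ 1ℤ * (u * x + v * (- (b₀ + k) * x - C * y) - μ * x)
          + 1ℤ * ((u - b₀ * v) * x + - v * (- (b₀ + k) * x - C * y) - μ̄ * x)
      at-x = solve-∀
      at-y : ∀ A b₀ k C u v μ μ̄ x y → (+ 2 * u - b₀ * v - μ - μ̄) * y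
        ≡ 1ℤ * (u * y + v * (A * x + k * y) - μ * y)
          + 1ℤ * ((u - b₀ * v) * y + - v * (A * x + k * y) - μ̄ * y)
      at-y = solve-∀

    -- For σ = u + v ω of norm p² and w = σ (x , y) / p², the conjugate of σ maps w back to
    -- (x , y), so ℓ(x , y) = p² ℓ(w).
    quotient : ∀ {u v} → norm u v ≡ P * P →
      P * P ∣ act₁ u v x y → P * P ∣ act₂ u v x y → Represents ℓ N
    quotient {u} {v} norm≡ (divides w₁ eq₁) (divides w₂ eq₂) =
      w₁ , w₂ , cancel-P² (begin
        eval ℓ w₁ w₂ * (P * P)                     ≡⟨ ℤ.*-comm _ (P * P) ⟩
        P * P * eval ℓ w₁ w₂                       ≡⟨ cong (_* eval ℓ w₁ w₂) (trans (norm-conj u v) norm≡) ⟨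
        norm ū v̄ * eval ℓ w₁ w₂                    ≡⟨ eval-act ū v̄ w₁ w₂ ⟨
        eval ℓ (act₁ ū v̄ w₁ w₂) (act₂ ū v̄ w₁ w₂)  ≡⟨ cong₂ (eval ℓ) conj-w≡x conj-w≡y ⟩
        eval ℓ x y                                 ≡⟨ rep ⟩
        N * (P * P)                                ∎)
      where
      open ≡-Reasoning
      ū = u - b₀ * v
      v̄ = - v
      norm·x = λ z → trans (cong (_* z) norm≡) (ℤ.*-comm (P * P) z)
      conj-w≡x : act₁ ū v̄ w₁ w₂ ≡ x
      conj-w≡x = cancel-P² (begin
        act₁ ū v̄ w₁ w₂ * (P * P)                   ≡⟨ proj₁ (act-scaled ū v̄ w₁ w₂ (P * P)) ⟨
        act₁ ū v̄ (w₁ * (P * P)) (w₂ * (P * P))     ≡⟨ cong₂ (act₁ ū v̄) eq₁ eq₂ ⟨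
        act₁ ū v̄ (act₁ u v x y) (act₂ u v x y)     ≡⟨ proj₁ (act-conj u v x y) ⟩
        norm u v * x                               ≡⟨ norm·x x ⟩
        x * (P * P)                                ∎)
      conj-w≡y : act₂ ū v̄ w₁ w₂ ≡ y
      conj-w≡y = cancel-P² (begin
        act₂ ū v̄ w₁ w₂ * (P * P)                   ≡⟨ proj₂ (act-scaled ū v̄ w₁ w₂ (P * P)) ⟨
        act₂ ū v̄ (w₁ * (P * P)) (w₂ * (P * P))     ≡⟨ cong₂ (act₂ ū v̄) eq₁ eq₂ ⟨
        act₂ ū v̄ (act₁ u v x y) (act₂ u v x y)     ≡⟨ proj₂ (act-conj u v x y) ⟩
        norm u v * y                               ≡⟨ norm·x y ⟩
        y * (P * P)                                ∎)

    descent-primitive : ∀ {u v} → norm u v ≡ P * P → ¬ P ∣ v → ¬ P ∣ disc ℓ → Represents ℓ N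
    descent-primitive {u} {v} norm≡ P∤v P∤D =
      by-eigenvalues (eigenvector u v) (eigenvector (u - b₀ * v) (- v))
      where
      by-eigenvalues : ∃[ μ ] Eigen (P * P) u v μ x y → ∃[ μ̄ ] Eigen (P * P) (u - b₀ * v) (- v) μ̄ x y →
                       Represents ℓ N
      by-eigenvalues (μ , eig) (μ̄ , eig̅) = by-divisibility (P ∣? μ) (P ∣? μ̄)
        where
        P²∣μμ̄ : P * P ∣ μ * μ̄
        P²∣μμ̄ = eigenvalue-product {u} {v} {μ} {μ̄} norm≡ eig eig̅
        by-divisibility : Dec (P ∣ μ) → Dec (P ∣ μ̄) → Represents ℓ N
        by-divisibility (no P∤μ) _ =
          uncurry (quotient {u - b₀ * v} { - v } (trans (norm-conj u v) norm≡))
            (P²∣eigenvalue⇒P²∣act {u - b₀ * v} { - v } {μ̄} eig̅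
              (cancel ∣-refl (subst (P * P ∣_) (ℤ.*-comm μ μ̄) P²∣μμ̄) P∤μ))
        by-divisibility (yes _) (no P∤μ̄) =
          uncurry (quotient {u} {v} norm≡)
            (P²∣eigenvalue⇒P²∣act {u} {v} {μ} eig (cancel ∣-refl P²∣μμ̄ P∤μ̄))
        by-divisibility (yes P∣μ) (yes P∣μ̄) =
          ⊥-elim (eigenvalues-not-both-divisible {u} {v} {μ} {μ̄} norm≡ P∤v P∤D
            (eigenvalue-sum {u} {v} {μ} {μ̄} eig eig̅) P∣μ P∣μ̄)


  descent : ∀ {s t N x y} → eval (form 1ℤ b₀ c₀) s t ≡ P * P → ¬ P ∣ t → ¬ P ∣ disc ℓ →
            eval ℓ x y ≡ N * (P * P) → Represents ℓ N
  descent {s} {t} {N} {x} {y} principal P∤t P∤D rep = by-cases (P ∣? x) (P ∣? y)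
    where
    conjugate-norm : ∀ b₀ c s t →
      s * s - b₀ * s * - t + c * - t * - t ≡ 1ℤ * s * s + b₀ * s * t + c * t * t
    conjugate-norm = solve-∀
    P∤-t : ¬ P ∣ - t
    P∤-t P∣-t = P∤t (subst (P ∣_) (ℤ.neg-involutive t) (∣m⇒∣-m P∣-t))
    primitive-case : p-Primitive x y → Represents ℓ N
    primitive-case prim = descent-primitive rep prim {s} { - t }
      (trans (conjugate-norm b₀ c₀ s t) principal) P∤-t P∤D
    by-cases : Dec (P ∣ x) → Dec (P ∣ y) → Represents ℓ N
    by-cases (yes P∣x) (yes P∣y) = descend ℓ P∣x P∣y rep
    by-cases (no P∤x) _ = primitive-case (λ (P∣x , _) → P∤x P∣x)
    by-cases (yes _) (no P∤y) = primitive-case (λ (_ , P∣y) → P∤y P∣y)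

c₀-formula : ∀ {A C b₀ c₀} k → disc (form A (b₀ + + 2 * k) C) ≡ disc (form 1ℤ b₀ c₀) →
  c₀ ≡ A * C - b₀ * k - k * k
c₀-formula {A} {C} {b₀} {c₀} k disc≡ = ℤ.*-cancelˡ-≡ (+ 4) c₀ (A * C - b₀ * k - k * k) (begin
  + 4 * c₀                                           ≡⟨ isolate b₀ c₀ ⟩
  b₀ * b₀ - disc (form 1ℤ b₀ c₀)                     ≡⟨ cong (_-_ (b₀ * b₀)) disc≡ ⟨
  b₀ * b₀ - disc (form A (b₀ + + 2 * k) C)           ≡⟨ expand A C b₀ k ⟩
  + 4 * (A * C - b₀ * k - k * k)                     ∎)
  where
  open ≡-Reasoning
  isolate : ∀ b₀ c₀ → + 4 * c₀ ≡ b₀ * b₀ - (b₀ * b₀ - + 4 * 1ℤ * c₀)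
  isolate = solve-∀
  expand : ∀ A C b₀ k →
    b₀ * b₀ - ((b₀ + + 2 * k) * (b₀ + + 2 * k) - + 4 * A * C) ≡ + 4 * (A * C - b₀ * k - k * k)
  expand = solve-∀

-- Equal discriminants force b ≡ b₀ (mod 2).
principal-offset : ∀ {A B C b₀ c₀} → disc (form A B C) ≡ disc (form 1ℤ b₀ c₀) →
  ∃[ k ] (B ≡ b₀ + + 2 * k × c₀ ≡ A * C - b₀ * k - k * k)
principal-offset {A} {B} {C} {b₀} {c₀} disc≡ with ModPrime.P∣x²⇒P∣x 2 prime[2] (divides X (begin
    (B - b₀) * (B - b₀)                  ≡⟨ square A B C b₀ c₀ ⟩
    X * + 2 + (disc (form A B C) - D₀)   ≡⟨ cong (λ d → X * + 2 + (d - D₀)) disc≡ ⟩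
    X * + 2 + (D₀ - D₀)                  ≡⟨ drop (X * + 2) D₀ ⟩
    X * + 2                              ∎))
  where
  open ≡-Reasoning
  D₀ = disc (form 1ℤ b₀ c₀)
  X = + 2 * (A * C - c₀) - b₀ * (B - b₀)
  square : ∀ A B C b₀ c₀ → (B - b₀) * (B - b₀)
    ≡ (+ 2 * (A * C - c₀) - b₀ * (B - b₀)) * + 2 + ((B * B - + 4 * A * C) - (b₀ * b₀ - + 4 * 1ℤ * c₀))
  square = solve-∀
  drop : ∀ e d → e + (d - d) ≡ e
  drop = solve-∀
... | divides k B-b₀≡ =
  k , B≡ , c₀-formula {A} {C} {b₀} {c₀} k (subst (λ B → disc (form A B C) ≡ disc (form 1ℤ b₀ c₀)) B≡ disc≡)
  where
  shift : ∀ B b₀ k → B - b₀ ≡ k * + 2 → B ≡ b₀ + + 2 * k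
  shift B b₀ k eq = trans (split B b₀) (trans (cong (_+_ b₀) eq) (reorder b₀ k))
    where
    split : ∀ B b₀ → B ≡ b₀ + (B - b₀)
    split = solve-∀
    reorder : ∀ b₀ k → b₀ + k * + 2 ≡ b₀ + + 2 * k
    reorder = solve-∀
  B≡ = shift B b₀ k B-b₀≡

module Descent (p : ℕ) (p-prime : Prime p) where
  open ModPrime p p-prime
  open AmbiguousSquare p p-prime

  inert-descent : ∀ ℓ {q N x y} → q ∣ + 4 * (P * P) →
    (∀ z w → ¬ P ∣ w → ¬ q ∣ z * z - disc ℓ * w * w) → eval ℓ x y ≡ N * (P * P) → Represents ℓ N
  inert-descent ℓ@(form A B C) {q} {N} {x} {y} q∣4P² nonresidue rep = descend ℓ P∣x P∣y rep
    where
    regroup : ∀ m N P → m * N * (+ 4 * (P * P)) ≡ + 4 * m * (N * (P * P))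
    regroup = solve-∀
    complete-y : ∀ A B C x y → (+ 2 * A * x + B * y) * (+ 2 * A * x + B * y) - (B * B - + 4 * A * C) * y * y
                               ≡ + 4 * A * (A * x * x + B * x * y + C * y * y)
    complete-y = solve-∀
    complete-x : ∀ A B C x y → (B * x + + 2 * C * y) * (B * x + + 2 * C * y) - (B * B - + 4 * A * C) * x * x
                               ≡ + 4 * C * (A * x * x + B * x * y + C * y * y)
    complete-x = solve-∀
    q∣4mQ : ∀ m → q ∣ + 4 * m * eval ℓ x y
    q∣4mQ m = subst (q ∣_) (trans (regroup m N P) (cong (+ 4 * m *_) (sym rep))) (∣n⇒∣m*n (m * N) q∣4P²)
    P∣y : P ∣ y
    P∣y = decidable-stable (P ∣? y) λ P∤y →
      nonresidue (+ 2 * A * x + B * y) y P∤y (subst (q ∣_) (sym (complete-y A B C x y)) (q∣4mQ A))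
    P∣x : P ∣ x
    P∣x = decidable-stable (P ∣? x) λ P∤x →
      nonresidue (B * x + + 2 * C * y) x P∤x (subst (q ∣_) (sym (complete-x A B C x y)) (q∣4mQ C))

  split-descent : ∀ ℓ {N x y} → ¬ P ∣ disc ℓ → PrincipalRepresentsP² (disc ℓ) →
    eval ℓ x y ≡ N * (P * P) → Represents ℓ N
  split-descent (form A B C) {N} {x} {y} P∤D σ rep =
    subst (λ B′ → Represents (form A B′ C) N) (sym B≡)
      (OrderAction.descent p p-prime A b₀ k C {s} {t} {N} {x} {y}
        (subst (λ c → eval (form 1ℤ b₀ c) s t ≡ P * P) c₀≡ represents) P∤t
        (subst (λ B′ → ¬ P ∣ disc (form A B′ C)) B≡ P∤D)
        (subst (λ B′ → eval (form A B′ C) x y ≡ N * (P * P)) B≡ rep))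
    where
    open PrincipalRepresentsP² σ
    offset = principal-offset {A} {B} {C} {b₀} {c₀} (sym disc≡)
    k = proj₁ offset
    B≡ = proj₁ (proj₂ offset)
    c₀≡ = proj₂ (proj₂ offset)

module PrimeTwo (p-prime : Prime 2) where
  open ModPrime 2 p-prime
  open AmbiguousSquare 2 p-prime

  2∣8 : + 2 ∣ + 8
  2∣8 = divides (+ 4) refl

  4∣8 : + 4 ∣ + 8
  4∣8 = divides (+ 2) refl

  parity : ∀ z → + 2 ∣ z ⊎ + 2 ∣ z - 1ℤ
  parity z with z %ℕ 2 | n%ℕd<d z 2 | a≡a%ℕn+[a/ℕn]*n z 2
  ... | 0 | _ | z≡ = inj₁ (divides (z /ℕ 2) (trans z≡ (ℤ.+-identityˡ _)))
  ... | 1 | _ | z≡ = inj₂ (divides (z /ℕ 2) (trans (cong (_- 1ℤ) z≡) (drop-one (z /ℕ 2 * + 2))))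
    where
    drop-one : ∀ e → 1ℤ + e - 1ℤ ≡ e
    drop-one = solve-∀
  ... | suc (suc _) | s≤s (s≤s ()) | _

  consecutive-even : ∀ m → + 2 ∣ m * (m + 1ℤ)
  consecutive-even m = [ ∣m⇒∣m*n (m + 1ℤ) , ∣n⇒∣m*n m ∘ 2∣m+1 ]′ (parity m)
    where
    shift : ∀ m → m + 1ℤ ≡ 1ℤ * (m - 1ℤ) + 1ℤ * + 2
    shift = solve-∀
    2∣m+1 : + 2 ∣ m - 1ℤ → + 2 ∣ m + 1ℤ
    2∣m+1 2∣m-1 = ∣-linear₂ 1ℤ 1ℤ (shift m) 2∣m-1 ∣-refl

  odd-square : ∀ z → + 2 ∣ z - 1ℤ → + 8 ∣ z * z - 1ℤ
  odd-square z (divides m z-1≡) = subst (+ 8 ∣_) (sym (begin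
    z * z - 1ℤ                       ≡⟨ factor z ⟩
    (z - 1ℤ) * (z - 1ℤ + + 2)        ≡⟨ cong (λ e → e * (e + + 2)) z-1≡ ⟩
    (m * + 2) * (m * + 2 + + 2)      ≡⟨ expand m ⟩
    + 4 * (m * (m + 1ℤ))             ∎)) (*-monoʳ-∣ (+ 4) (consecutive-even m))
    where
    open ≡-Reasoning
    factor : ∀ z → z * z - 1ℤ ≡ (z - 1ℤ) * (z - 1ℤ + + 2)
    factor = solve-∀
    expand : ∀ m → (m * + 2) * (m * + 2 + + 2) ≡ + 4 * (m * (m + 1ℤ))
    expand = solve-∀

  disc-not-3-mod-8 : ∀ f → ¬ + 8 ∣ disc f - + 3
  disc-not-3-mod-8 (form A B C) 8∣D-3 = [ even , odd ]′ (parity B)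
    where
    three : ∀ m A C →
      + 3 ≡ (+ 2 * m * m - + 2 * A * C) * + 2 + - 1ℤ * ((m * + 2) * (m * + 2) - + 4 * A * C - + 3)
    three = solve-∀
    two : ∀ B A C → + 2 ≡ 1ℤ * (B * B - 1ℤ) + - 1ℤ * (B * B - + 4 * A * C - + 3) + - (A * C) * + 4
    two = solve-∀
    even : + 2 ∣ B → ⊥
    even (divides m refl) = from-no (+ 2 ∣? + 3)
      (∣-linear₂ (+ 2 * m * m - + 2 * A * C) (- 1ℤ) (three m A C) ∣-refl (∣-trans 2∣8 8∣D-3))
    odd : + 2 ∣ B - 1ℤ → ⊥
    odd 2∣B-1 = from-no (+ 4 ∣? + 2)
      (∣-linear₃ 1ℤ (- 1ℤ) (- (A * C)) (two B A C)
        (∣-trans 4∣8 (odd-square B 2∣B-1)) (∣-trans 4∣8 8∣D-3) ∣-refl)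

  nonresidue-mod-8 : ∀ {D} → + 8 ∣ D + + 3 → ∀ z w → ¬ + 2 ∣ w → ¬ + 8 ∣ z * z - D * w * w
  nonresidue-mod-8 {D} 8∣D+3 z w 2∤w 8∣z²-Dw² = [ 2∤w , odd-w ]′ (parity w)
    where
    four : ∀ z D w →
      + 4 ≡ 1ℤ * (D + + 3) + - 1ℤ * (z * z - 1ℤ) + 1ℤ * (z * z - D * w * w) + D * (w * w - 1ℤ)
    four = solve-∀
    rest : ∀ m D w → D * w * w ≡ (+ 2 * m * m) * + 2 + - 1ℤ * ((m * + 2) * (m * + 2) - D * w * w)
    rest = solve-∀
    three : ∀ D → + 3 ≡ 1ℤ * (D + + 3) + - 1ℤ * D
    three = solve-∀
    2∤D : ¬ + 2 ∣ D
    2∤D 2∣D = from-no (+ 2 ∣? + 3) (∣-linear₂ 1ℤ (- 1ℤ) (three D) (∣-trans 2∣8 8∣D+3) 2∣D)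
    odd-w : + 2 ∣ w - 1ℤ → ⊥
    odd-w 2∣w-1 = [ even-z , odd-z ]′ (parity z)
      where
      odd-z : + 2 ∣ z - 1ℤ → ⊥
      odd-z 2∣z-1 = from-no (+ 8 ∣? + 4)
        (∣-linear₄ 1ℤ (- 1ℤ) 1ℤ D (four z D w) 8∣D+3 (odd-square z 2∣z-1) 8∣z²-Dw² (odd-square w 2∣w-1))
      even-z : + 2 ∣ z → ⊥
      even-z (divides m refl) =
        [ [ 2∤D , 2∤w ]′ ∘ P∣xy⇒P∣x⊎P∣y D w , 2∤w ]′ (P∣xy⇒P∣x⊎P∣y (D * w) w 2∣Dw²)
        where
        2∣Dw² : + 2 ∣ D * w * w
        2∣Dw² = ∣-linear₂ (+ 2 * m * m) (- 1ℤ) (rest m D w) ∣-refl (∣-trans 2∣8 8∣z²-Dw²)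

  odd-disc : ∀ {D} → + 8 ∣ D - 1ℤ ⊎ + 8 ∣ D + 1ℤ → ¬ + 2 ∣ D
  odd-disc {D} (inj₁ 8∣D-1) 2∣D = P∤1 (∣-linear₂ (- 1ℤ) 1ℤ (one D) (∣-trans 2∣8 8∣D-1) 2∣D)
    where
    one : ∀ D → 1ℤ ≡ - 1ℤ * (D - 1ℤ) + 1ℤ * D
    one = solve-∀
  odd-disc {D} (inj₂ 8∣D+1) 2∣D = P∤1 (∣-linear₂ 1ℤ (- 1ℤ) (one D) (∣-trans 2∣8 8∣D+1) 2∣D)
    where
    one : ∀ D → 1ℤ ≡ 1ℤ * (D + 1ℤ) + - 1ℤ * D
    one = solve-∀

  label-modulus-4 : ∀ {D} → ¬ + 2 ∣ D → LabelModulus (+ 4) D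
  label-modulus-4 {D} 2∤D = record
    { q∣P² = ∣-refl ; q∣2P = ∣-refl ; halve = halve ; roots-distinct = roots-distinct }
    where
    halve : ∀ {z} → + 4 ∣ + 2 * z → + 2 ∣ z
    halve {z} (divides r 2z≡) = divides r (ℤ.*-cancelˡ-≡ (+ 2) z (r * + 2) (trans 2z≡ (regroup r)))
      where
      regroup : ∀ r → r * + 4 ≡ + 2 * (r * + 2)
      regroup = solve-∀
    roots-distinct : ∀ {ρ} → + 4 ∣ D - ρ * ρ → ¬ + 4 ∣ + 2 * ρ
    roots-distinct {ρ} 4∣D-ρ² 4∣2ρ with halve 4∣2ρ
    ... | divides m refl = 2∤D (∣-trans (divides (+ 2) refl) (∣-linear₂ 1ℤ (m * m) (split D m) 4∣D-ρ² ∣-refl))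
      where
      split : ∀ D m → D ≡ 1ℤ * (D - m * + 2 * (m * + 2)) + m * m * + 4
      split = solve-∀

module OddPrime (p : ℕ) (p-prime : Prime p) (p≢2 : p ≢ 2) where
  open ModPrime p p-prime
  open AmbiguousSquare p p-prime

  P∤2 : ¬ P ∣ + 2
  P∤2 P∣2 = [ ¬prime[1] ∘ (λ p≡1 → subst Prime p≡1 p-prime) , p≢2 ]′
    (prime⇒irreducible prime[2] (∣⇒∣ᵤ P∣2))

  halve : ∀ {z} → P ∣ + 2 * z → P ∣ z
  halve {z} P∣2z = [ ⊥-elim ∘ P∤2 , id ]′ (P∣xy⇒P∣x⊎P∣y (+ 2) z P∣2z)

  label-modulus-p : ∀ {D} → ¬ P ∣ D → LabelModulus P D
  label-modulus-p {D} P∤D = record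
    { q∣P² = divides P refl ; q∣2P = divides (+ 2) refl ; halve = halve ; roots-distinct = roots-distinct }
    where
    split : ∀ D ρ → D ≡ 1ℤ * (D - ρ * ρ) + ρ * ρ
    split = solve-∀
    roots-distinct : ∀ {ρ} → P ∣ D - ρ * ρ → ¬ P ∣ + 2 * ρ
    roots-distinct {ρ} P∣D-ρ² P∣2ρ = P∤D (∣-linear₂ 1ℤ ρ (split D ρ) P∣D-ρ² (halve P∣2ρ))

  nonresidue-mod-p : ∀ {D} → ¬ QR D p → ∀ z w → ¬ P ∣ w → ¬ P ∣ z * z - D * w * w
  nonresidue-mod-p {D} ¬QR z w P∤w P∣z²-Dw² =
    let (w⁻¹ , P∣ww⁻¹-1) = inverse P∤w in
    ¬QR (z * w⁻¹ , ∣⇒∣ᵤ (∣-linear₂ (w⁻¹ * w⁻¹) (D * (w * w⁻¹ + 1ℤ)) (divide z w w⁻¹ D) P∣z²-Dw² P∣ww⁻¹-1))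
    where
    divide : ∀ z w w⁻¹ D → z * w⁻¹ * (z * w⁻¹) - D
      ≡ w⁻¹ * w⁻¹ * (z * z - D * w * w) + D * (w * w⁻¹ + 1ℤ) * (w * w⁻¹ - 1ℤ)
    divide = solve-∀

inert-case : ∀ {p} → Prime p → ∀ ℓ {N x y} → KronMinusOne (disc ℓ) p →
  eval ℓ x y ≡ N * (+ p * + p) → Represents ℓ N
inert-case p-prime ℓ (inj₁ (refl , inj₁ 8∣D-3)) _ =
  ⊥-elim (PrimeTwo.disc-not-3-mod-8 p-prime ℓ (∣ᵤ⇒∣ {+ 8} {disc ℓ - + 3} 8∣D-3))
inert-case p-prime ℓ {N} {x} {y} (inj₁ (refl , inj₂ 8∣D+3)) rep =
  Descent.inert-descent 2 p-prime ℓ {+ 8} {N} {x} {y} (divides (+ 2) refl)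
    (PrimeTwo.nonresidue-mod-8 p-prime {disc ℓ} (∣ᵤ⇒∣ {+ 8} {disc ℓ + + 3} 8∣D+3)) rep
inert-case {p} p-prime ℓ {N} {x} {y} (inj₂ (p≢2 , _ , ¬QR)) rep =
  Descent.inert-descent p p-prime ℓ {+ p} {N} {x} {y} (divides (+ 4 * + p) (regroup (+ p)))
    (OddPrime.nonresidue-mod-p p p-prime p≢2 {disc ℓ} ¬QR) rep
  where
  regroup : ∀ P → + 4 * (P * P) ≡ + 4 * P * P
  regroup = solve-∀

split-modulus : ∀ {p} (p-prime : Prime p) {D} → KronOne D p →
  ∃[ q ] (AmbiguousSquare.LabelModulus p p-prime q D × ¬ + p ∣ D)
split-modulus p-prime {D} (inj₁ (refl , 8∣D∓1)) =
  let 2∤D = PrimeTwo.odd-disc p-prime (Sum.map (∣ᵤ⇒∣ {+ 8} {D - 1ℤ}) (∣ᵤ⇒∣ {+ 8} {D + 1ℤ}) 8∣D∓1)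
  in + 4 , PrimeTwo.label-modulus-4 p-prime 2∤D , 2∤D
split-modulus {p} p-prime (inj₂ (p≢2 , p∤D , _)) =
  let P∤D = p∤D ∘ ∣⇒∣ᵤ in + p , OddPrime.label-modulus-p p p-prime p≢2 P∤D , P∤D

split-case : ∀ {p} (p-prime : Prime p) ℓ {N x y} → disc ℓ < 0ℤ →
  KronOne (disc ℓ) p → InAmbiguousQ (disc ℓ) p → eval ℓ x y ≡ N * (+ p * + p) → Represents ℓ N
split-case {p} p-prime ℓ {N} {x} {y} D<0 kron (g , _ , _ , disc-g , ambiguous , g-rep) rep =
  let (q , Q , P∤D) = split-modulus p-prime kron in
  Descent.split-descent p p-prime ℓ {N} {x} {y} P∤D
    (AmbiguousSquare.ambiguous-square p p-prime Q D<0 {g} disc-g ambiguous g-rep) rep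

proposition2p3 : (n : ℕ) → (ℓ : Form) → PosDef ℓ → Primitive ℓ →
    (p : ℕ) → Prime p →
    (KronMinusOne (disc ℓ) p ⊎ (KronOne (disc ℓ) p × InAmbiguousQ (disc ℓ) p)) →
    Represents ℓ ((+ (suc n)) * ((+ p) * (+ p))) → Represents ℓ (+ (suc n))
proposition2p3 n ℓ _ _ p p-prime (inj₁ inert) (x , y , rep) =
  inert-case p-prime ℓ {+ suc n} {x} {y} inert rep
proposition2p3 n ℓ (_ , D<0) _ p p-prime (inj₂ (split , ambiguous)) (x , y , rep) =
  split-case p-prime ℓ {+ suc n} {x} {y} D<0 split ambiguous rep
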